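{- Let $s,a\geq 2$ be integers and let $G$ be a graph with fewer than $t(s,a-1)$ edges. Let $L_1,\dots,L_a\subseteq V(G)$ be sets of size $s$. Then there exist distinct vertices $u_1,\dots,u_a$ with $u_i\in L_i$ for each $i$ such that $\{u_1,\dots,u_a\}$ is an independent set in $G$.
   Context: For positive integers $s$ and $k$, $t(s,k)=\min\sum_{i=1}^{k}\binom{d_i}{2}$, where the minimum is taken over all sequences $(d_1,\dots,d_k)$ of non-negative integers with $\sum_{i=1}^k d_i=s$. -}

module Defs where

open import Data.Nat using (ℕ; zero; suc; _+_; _∸_; _⊓_; _<_)
open import Data.Nat.Combinatorics using (_C_)
open import Data.Fin using (Fin)
open import Data.Product using (_×_; _,_; proj₁; proj₂)
open import Data.List using (List; []; _∷_; length; upTo; map; foldr)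
open import Data.Vec.Functional using (Vector)
open import Data.Vec.Functional using () renaming (foldr to vfoldr)
open import Relation.Binary.PropositionalEquality using (_≡_; _≢_)
open import Data.Fin using () renaming (_<_ to _<ᶠ_)
open import Data.List.Relation.Unary.All using (All)
open import Data.List.Relation.Unary.Unique.Propositional using (Unique)
open import Data.List.Membership.Propositional using (_∈_)
open import Data.Empty using (⊥)

Σᵥ : ∀ {k} → Vector ℕ k → ℕ
Σᵥ = vfoldr _+_ 0

-- t s k = min Σᵢ C(dᵢ,2) over sequences (d₁,…,dₖ) of naturals with Σ dᵢ = s (k ≥ 1).
-- Computed by recursion on the first entry d₁ ∈ {0,…,s}:
--   t s 1 = C(s,2),   t s (k+1) = min_{0 ≤ d ≤ s} ( C(d,2) + t (s ∸ d) k ).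
-- (t s 0 is set to 0; it is never used, since the theorem only uses k = a-1 ≥ 1.)
-- minFrom f m = min { f d | d ≤ m }
minFrom : (ℕ → ℕ) → ℕ → ℕ
minFrom f zero    = f zero
minFrom f (suc m) = minFrom f m ⊓ f (suc m)

t : ℕ → ℕ → ℕ
t s zero          = 0
t s (suc zero)    = s C 2
t s (suc (suc k)) = minFrom (λ d → d C 2 + t (s ∸ d) (suc k)) s

cost : ∀ {k} → Vector ℕ k → ℕ
cost d = Σᵥ (λ i → d i C 2)

record Graph (n : ℕ) : Set where
  field
    edges    : List (Fin n × Fin n)
    ordered  : All (λ e → proj₁ e <ᶠ proj₂ e) edges
    distinct : Unique edges

open Graph public

adjacent : ∀ {n} → Graph n → Fin n → Fin n → Set
adjacent G u v = ((u , v) ∈ edges G) Data.Sum.⊎ ((v , u) ∈ edges G)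
  where import Data.Sum

numEdges : ∀ {n} → Graph n → ℕ
numEdges G = length (edges G)

-- Greedy deletion of a closed neighbourhood. Let W be the union of the lists and v a vertex of
-- minimum degree d in G[W], say v ∈ L_j. The closed neighbourhood N of v in W has m ≤ d + 1
-- vertices, each of degree at least d in G[W], so at least md/2 ≥ C(m,2) edges of G[W] meet N.
-- Deleting N from the other a − 1 lists leaves lists of size at least s − m spanning fewer than
-- t(s,a−1) − C(m,2) ≤ t(s−m,a−2) edges; an independent transversal of these, found by induction,
-- avoids v and its neighbours, so v can be added to it.
module Submission where

open import Defs
open import Data.Nat using (ℕ; _≤_; _<_; _∸_)
open import Data.Fin using (Fin)
open import Data.Fin.Subset using (Subset; _∈_; ∣_∣)
open import Data.Product using (Σ; _×_)
open import Relation.Binary.PropositionalEquality using (_≡_; _≢_)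
open import Relation.Nullary using (¬_)

open import Data.Bool using (Bool; true; false; T; _∧_; _∨_; not)
open import Data.Bool.Properties using (T-≡; T-∧; T-∨)
open import Data.Empty using (⊥; ⊥-elim)
open import Data.Fin using (zero; suc; punchIn)
open import Data.Fin.Properties as Fin using (_≟_; any?; punchIn-punchOut)
open import Data.List using (List; []; _∷_; length; filter; allFin)
open import Data.List.Extrema.Nat using (argmin; argmin-all; f[argmin]≤f[xs])
open import Data.List.Membership.Propositional using () renaming (_∈_ to _∈ₗ_)
open import Data.List.Membership.Propositional.Properties using (∈-filter⁺; ∈-allFin)
open import Data.List.Relation.Unary.All as All using ()
open import Data.List.Relation.Unary.All.Properties using (all-filter)
open import Data.Nat using (zero; suc; _+_; _*_; z≤n; s≤s; z<s)
open import Data.Nat.Combinatorics using (_C_; nC1≡n; nCk+nC[k+1]≡[n+1]C[k+1])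
open import Data.Nat.Properties
  using ( ≤-refl; ≤-reflexive; ≤-trans; ≤-<-trans; <⇒≤; ≰⇒>; <-irrefl; n≮0; m≤n+m
        ; m≤n⇒m<n∨m≡n; m<1+n⇒m≤n; m<n⇒0<n∸m; m≤n+o⇒m∸n≤o; n∸n≡0; m⊓n≤m; m⊓n≤n
        ; +-identityʳ; +-comm; +-mono-≤; +-monoˡ-≤; +-monoʳ-≤; +-cancelʳ-<
        ; *-identityˡ; *-identityʳ; *-distribˡ-+; *-distribʳ-+; *-mono-≤; *-monoʳ-≤; *-monoʳ-<
        ; +-0-commutativeMonoid; +-*-semiring; module ≤-Reasoning )
open import Algebra.Properties.CommutativeMonoid.Sum +-0-commutativeMonoid
  using (sum-syntax; ∑-distrib-+; ∑-comm; sum-cong-≗; sum-replicate-zero)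
open import Algebra.Properties.Semiring.Sum +-*-semiring using (*-distribˡ-sum; *-distribʳ-sum)
open import Data.Nat.Tactic.RingSolver using (solve)
open import Data.Product using (_,_; proj₁; proj₂; ∃)
open import Data.Product.Properties using (≡-dec; ,-injective)
open import Data.Sum as Sum using (_⊎_; inj₁; inj₂; [_,_])
open import Data.Unit using (tt)
open import Data.Vec as Vec using (lookup)
open import Data.Vec.Functional using (insertAt)
open import Data.Vec.Functional.Properties using (insertAt-lookup; insertAt-punchIn)
open import Data.Vec.Properties using (lookup⇒[]=)
open import Function using (_∘_; Equivalence; mk⇔)
open import Relation.Binary.Definitions using (DecidableEquality)
open import Relation.Binary.PropositionalEquality
  using (refl; sym; trans; cong; cong₂; subst; subst₂; module ≡-Reasoning)
open import Relation.Nullary using (Dec; does; isYes; yes; no; _⊎-dec_; _×-dec_; contradiction)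
open import Relation.Nullary.Decidable using (T?; toWitness; fromWitness; dec-true; dec-false; does-⇔)

open Equivalence using (to; from)

𝟙 : Bool → ℕ
𝟙 false = 0
𝟙 true  = 1

𝟙-mono : ∀ {a b} → (T a → T b) → 𝟙 a ≤ 𝟙 b
𝟙-mono {false}         _   = z≤n
𝟙-mono {true} {true}   _   = ≤-refl
𝟙-mono {true} {false} a⇒b = ⊥-elim (a⇒b tt)

𝟙-∨ : ∀ a b → 𝟙 (a ∨ b) ≤ 𝟙 a + 𝟙 b
𝟙-∨ false b = ≤-refl
𝟙-∨ true  b = s≤s z≤n

𝟙-∧ : ∀ a b → 𝟙 (a ∧ b) ≡ 𝟙 a * 𝟙 b
𝟙-∧ false b = refl
𝟙-∧ true  b = sym (+-identityʳ (𝟙 b))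

𝟙-≤-∧-not : ∀ a b → 𝟙 a ≤ 𝟙 b + 𝟙 (a ∧ not b)
𝟙-≤-∧-not false b     = z≤n
𝟙-≤-∧-not true  false = ≤-refl
𝟙-≤-∧-not true  true  = ≤-refl

𝟙-split : ∀ {a b} → (T b → T a) → 𝟙 a ≡ 𝟙 (a ∧ not b) + 𝟙 b
𝟙-split {true}  {true}  _   = refl
𝟙-split {true}  {false} _   = refl
𝟙-split {false} {false} _   = refl
𝟙-split {false} {true}  b⇒a = ⊥-elim (b⇒a tt)

𝟙*-monoʳ : ∀ b {m o} → (T b → m ≤ o) → 𝟙 b * m ≤ 𝟙 b * o
𝟙*-monoʳ false _   = z≤n
𝟙*-monoʳ true  m≤o = *-monoʳ-≤ 1 (m≤o tt)

T-∧-mapˡ : ∀ {a b} c → (T a → T b) → T (a ∧ c) → T (b ∧ c)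
T-∧-mapˡ {a} {b} c a⇒b a∧c =
  let (ta , tc) = to (T-∧ {a} {c}) a∧c in from (T-∧ {b} {c}) (a⇒b ta , tc)

∑-mono-≤ : ∀ {k} {f g : Fin k → ℕ} → (∀ i → f i ≤ g i)
         → ∑[ i < k ] f i ≤ ∑[ i < k ] g i
∑-mono-≤ {zero}  _   = z≤n
∑-mono-≤ {suc k} f≤g = +-mono-≤ (f≤g zero) (∑-mono-≤ (f≤g ∘ suc))

∑∑-mono-≤ : ∀ {k l} {f g : Fin k → Fin l → ℕ} → (∀ i j → f i j ≤ g i j)
          → ∑[ i < k ] ∑[ j < l ] f i j ≤ ∑[ i < k ] ∑[ j < l ] g i j
∑∑-mono-≤ f≤g = ∑-mono-≤ λ i → ∑-mono-≤ (f≤g i)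

∑∑-distrib-+ : ∀ {k l} (f g : Fin k → Fin l → ℕ)
             → ∑[ i < k ] ∑[ j < l ] (f i j + g i j)
               ≡ ∑[ i < k ] ∑[ j < l ] f i j + ∑[ i < k ] ∑[ j < l ] g i j
∑∑-distrib-+ {k} {l} f g = trans (sum-cong-≗ {k} λ i → ∑-distrib-+ (f i) (g i))
                                 (∑-distrib-+ (λ i → ∑[ j < l ] f i j) (λ i → ∑[ j < l ] g i j))

δ : ∀ {k} → Fin k → Fin k → ℕ
δ x y = 𝟙 (does (x ≟ y))

∑-δ : ∀ {n} (v : Fin n) → ∑[ x < n ] δ x v ≡ 1
∑-δ {suc n} zero    = cong suc (sum-replicate-zero n)
∑-δ         (suc v) = ∑-δ v

C2-suc : ∀ m → suc m C 2 ≡ m + m C 2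
C2-suc m = begin
  suc m C 2       ≡⟨ nCk+nC[k+1]≡[n+1]C[k+1] m 1 ⟨
  m C 1 + m C 2   ≡⟨ cong (_+ m C 2) (nC1≡n m) ⟩
  m + m C 2       ∎
  where open ≡-Reasoning

C2-mono : ∀ {m n} → m ≤ n → m C 2 ≤ n C 2
C2-mono {zero}          _         = z≤n
C2-mono {suc m} {suc n} (s≤s m≤n) =
  subst₂ _≤_ (sym (C2-suc m)) (sym (C2-suc n)) (+-mono-≤ m≤n (C2-mono m≤n))

C2-double-suc : ∀ m → 2 * (suc m C 2) ≡ suc m * m
C2-double-suc zero    = refl
C2-double-suc (suc m) = begin
  2 * (suc (suc m) C 2)          ≡⟨ cong (2 *_) (C2-suc (suc m)) ⟩
  2 * (suc m + suc m C 2)        ≡⟨ *-distribˡ-+ 2 (suc m) _ ⟩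
  2 * suc m + 2 * (suc m C 2)    ≡⟨ cong (2 * suc m +_) (C2-double-suc m) ⟩
  2 * suc m + suc m * m          ≡⟨ solve (m ∷ []) ⟩
  suc (suc m) * suc m            ∎
  where open ≡-Reasoning

C2-double≤ : ∀ {m d} → m ≤ suc d → 2 * (m C 2) ≤ m * d
C2-double≤ {zero}  _         = z≤n
C2-double≤ {suc m} (s≤s m≤d) = ≤-trans (≤-reflexive (C2-double-suc m)) (*-monoʳ-≤ (suc m) m≤d)

minFrom-≤ : ∀ f {m d} → d ≤ m → minFrom f m ≤ f d
minFrom-≤ f {zero}  z≤n = ≤-refl
minFrom-≤ f {suc m} d≤1+m with m≤n⇒m<n∨m≡n d≤1+m
... | inj₁ d<1+m = ≤-trans (m⊓n≤m _ _) (minFrom-≤ f (m<1+n⇒m≤n d<1+m))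
... | inj₂ refl  = m⊓n≤n _ _

t-split : ∀ k s {m} → m ≤ s → t s (suc (suc k)) ≤ m C 2 + t (s ∸ m) (suc k)
t-split k s = minFrom-≤ (λ d → d C 2 + t (s ∸ d) (suc k))

t-zero : ∀ k → t 0 (suc k) ≡ 0
t-zero zero    = refl
t-zero (suc k) = t-zero k

t≤C2 : ∀ k s → t s (suc k) ≤ s C 2
t≤C2 zero    s = ≤-refl
t≤C2 (suc k) s = begin
  t s (suc (suc k))          ≤⟨ t-split k s ≤-refl ⟩
  s C 2 + t (s ∸ s) (suc k)  ≡⟨ cong (λ r → s C 2 + t r (suc k)) (n∸n≡0 s) ⟩
  s C 2 + t 0 (suc k)        ≡⟨ cong (s C 2 +_) (t-zero k) ⟩
  s C 2 + 0                  ≡⟨ +-identityʳ _ ⟩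
  s C 2                      ∎
  where open ≤-Reasoning

-- p counts ordered adjacent pairs, i.e. twice the edges. For k = 0 the paper's t(s,0) = ∞
-- (for s > 0 no empty sequence sums to s) replaces the junk value t s 0 = 0.
BelowThreshold : ℕ → ℕ → ℕ → Set
BelowThreshold s zero    p = 0 < s
BelowThreshold s (suc k) p = p < 2 * t s (suc k)

BelowThreshold⇒0<s : ∀ k {s p} → BelowThreshold s k p → 0 < s
BelowThreshold⇒0<s zero                below = below
BelowThreshold⇒0<s (suc k) {zero} {p} below =
  contradiction (subst (λ r → p < 2 * r) (t-zero k) below) n≮0
BelowThreshold⇒0<s (suc k) {suc s}    _     = z<s

BelowThreshold-step : ∀ k {s m d p p′} → m ≤ suc d → p′ + m * d ≤ p
                    → BelowThreshold s (suc k) p → BelowThreshold (s ∸ m) k p′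
BelowThreshold-step k {s} {m} {d} {p} {p′} m≤1+d removed below = conclude k below
  where
  removed′ : p′ + 2 * (m C 2) ≤ p
  removed′ = ≤-trans (+-monoʳ-≤ p′ (C2-double≤ m≤1+d)) removed

  m<s : m < s
  m<s = ≰⇒> λ s≤m → <-irrefl refl (begin-strict
    2 * (s C 2)         ≤⟨ *-monoʳ-≤ 2 (C2-mono s≤m) ⟩
    2 * (m C 2)         ≤⟨ m≤n+m _ p′ ⟩
    p′ + 2 * (m C 2)    ≤⟨ removed′ ⟩
    p                   <⟨ below ⟩
    2 * t s (suc k)     ≤⟨ *-monoʳ-≤ 2 (t≤C2 k s) ⟩
    2 * (s C 2)         ∎)
    where open ≤-Reasoning

  conclude : ∀ k → BelowThreshold s (suc k) p → BelowThreshold (s ∸ m) k p′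
  conclude zero    _     = m<n⇒0<n∸m m<s
  conclude (suc k) below = +-cancelʳ-< (2 * (m C 2)) p′ _ (begin-strict
    p′ + 2 * (m C 2)                        ≤⟨ removed′ ⟩
    p                                       <⟨ below ⟩
    2 * t s (suc (suc k))                   ≤⟨ *-monoʳ-≤ 2 (t-split k s (<⇒≤ m<s)) ⟩
    2 * (m C 2 + t (s ∸ m) (suc k))         ≡⟨ *-distribˡ-+ 2 (m C 2) _ ⟩
    2 * (m C 2) + 2 * t (s ∸ m) (suc k)     ≡⟨ +-comm (2 * (m C 2)) _ ⟩
    2 * t (s ∸ m) (suc k) + 2 * (m C 2)     ∎)
    where open ≤-Reasoning

-- Vertex sets are characteristic functions, so that sizes and edge counts are sums of indicators.
VSet : ℕ → Set
VSet n = Fin n → Bool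

module _ {n : ℕ} where

  infix  4 _⊆_
  infixl 5 _─_

  _⊆_ : VSet n → VSet n → Set
  P ⊆ Q = ∀ x → T (P x) → T (Q x)

  _─_ : VSet n → VSet n → VSet n
  (P ─ Q) x = P x ∧ not (Q x)

  ⋃ : ∀ {a} → (Fin a → VSet n) → VSet n
  ⋃ L x = isYes (any? λ i → T? (L i x))

  size : VSet n → ℕ
  size P = ∑[ x < n ] 𝟙 (P x)

  ─-⊆ : ∀ P Q → P ─ Q ⊆ P
  ─-⊆ P Q x = proj₁ ∘ to (T-∧ {P x})

  ─-∉ : ∀ P Q x → T ((P ─ Q) x) → ¬ T (Q x)
  ─-∉ P Q x x∈P─Q with Q x
  ... | false = λ ()
  ... | true  = ⊥-elim (proj₂ (to (T-∧ {P x}) x∈P─Q))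

  ─-monoˡ : ∀ {P Q} R → P ⊆ Q → P ─ R ⊆ Q ─ R
  ─-monoˡ R P⊆Q x = T-∧-mapˡ (not (R x)) (P⊆Q x)

  ⊆-⋃ : ∀ {a} (L : Fin a → VSet n) i → L i ⊆ ⋃ L
  ⊆-⋃ L i x x∈Li = fromWitness (i , x∈Li)

  ∈⋃⁻ : ∀ {a} (L : Fin a → VSet n) {x} → T (⋃ L x) → ∃ λ i → T (L i x)
  ∈⋃⁻ L = toWitness

  ⋃-least : ∀ {a} {L : Fin a → VSet n} {Q} → (∀ i → L i ⊆ Q) → ⋃ L ⊆ Q
  ⋃-least {L = L} L⊆Q x x∈⋃L = let (i , x∈Li) = ∈⋃⁻ L x∈⋃L in L⊆Q i x x∈Li

  size-─ : ∀ P Q → size P ≤ size Q + size (P ─ Q)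
  size-─ P Q = begin
    ∑[ x < n ] 𝟙 (P x)                      ≤⟨ ∑-mono-≤ (λ x → 𝟙-≤-∧-not (P x) (Q x)) ⟩
    ∑[ x < n ] (𝟙 (Q x) + 𝟙 ((P ─ Q) x))    ≡⟨ ∑-distrib-+ (𝟙 ∘ Q) (𝟙 ∘ (P ─ Q)) ⟩
    size Q + size (P ─ Q)                   ∎
    where open ≤-Reasoning

  size-pos⇒nonempty : ∀ P → 0 < size P → ∃ λ x → T (P x)
  size-pos⇒nonempty P 0<size with any? (λ x → T? (P x))
  ... | yes ∃x = ∃x
  ... | no  ∄x = contradiction (≤-trans 0<size empty) (<-irrefl refl)
    where
    empty : size P ≤ 0
    empty = ≤-trans (∑-mono-≤ (λ x → 𝟙-mono (∄x ∘ (x ,_)))) (≤-reflexive (sum-replicate-zero n))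

  ∃-argmin : ∀ (P : VSet n) (f : Fin n → ℕ) {w} → T (P w)
           → ∃ λ v → T (P v) × (∀ x → T (P x) → f v ≤ f x)
  ∃-argmin P f {w} w∈P = v , argmin-all f {P = T ∘ P} w∈P (all-filter P? (allFin n)) , minimal
    where
    P? : ∀ x → Dec (T (P x))
    P? x = T? (P x)
    xs : List (Fin n)
    xs = filter P? (allFin n)
    v : Fin n
    v = argmin f w xs
    minimal : ∀ x → T (P x) → f v ≤ f x
    minimal x x∈P = All.lookup (f[argmin]≤f[xs] w xs) (∈-filter⁺ P? (∈-allFin x) x∈P)

data Slot {a} (j : Fin (suc a)) : Fin (suc a) → Set where
  at    : Slot j j
  other : ∀ i → Slot j (punchIn j i)

slot : ∀ {a} (j k : Fin (suc a)) → Slot j k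
slot j k with k ≟ j
... | yes refl = at
... | no  k≢j  = subst (Slot j) (punchIn-punchOut (k≢j ∘ sym)) (other _)

module Greedy {n} (A : Fin n → Fin n → Bool) (A-sym : ∀ x y → A x y ≡ A y x) where

  degree : VSet n → Fin n → ℕ
  degree W x = ∑[ y < n ] 𝟙 (W y ∧ A x y)

  pairs : VSet n → ℕ
  pairs W = ∑[ x < n ] (𝟙 (W x) * degree W x)

  closedNbhd : VSet n → Fin n → VSet n
  closedNbhd W v x = W x ∧ (does (x ≟ v) ∨ A v x)

  degree-mono : ∀ {W V} → W ⊆ V → ∀ x → degree W x ≤ degree V x
  degree-mono W⊆V x = ∑-mono-≤ λ y → 𝟙-mono (T-∧-mapˡ (A x y) (W⊆V y))

  pairs-mono : ∀ {W V} → W ⊆ V → pairs W ≤ pairs V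
  pairs-mono W⊆V = ∑-mono-≤ λ x → *-mono-≤ (𝟙-mono (W⊆V x)) (degree-mono W⊆V x)

  pairs≤∑∑ : ∀ W → pairs W ≤ ∑[ x < n ] ∑[ y < n ] 𝟙 (A x y)
  pairs≤∑∑ W = ≤-trans (pairs-mono {W} {λ _ → true} (λ _ _ → tt))
                       (≤-reflexive (sum-cong-≗ {n} λ x → *-identityˡ (degree (λ _ → true) x)))

  pairs-─ : ∀ W N {d} → N ⊆ W → (∀ x → T (W x) → d ≤ degree W x)
          → pairs (W ─ N) + size N * d ≤ pairs W
  pairs-─ W N {d} N⊆W d≤deg = begin
    pairs (W ─ N) + size N * d
      ≡⟨ cong (pairs (W ─ N) +_) (*-distribʳ-sum d (𝟙 ∘ N)) ⟩
    ∑[ x < n ] (𝟙 ((W ─ N) x) * degree (W ─ N) x) + ∑[ x < n ] (𝟙 (N x) * d)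
      ≤⟨ +-mono-≤ (∑-mono-≤ λ x → *-monoʳ-≤ (𝟙 ((W ─ N) x)) (degree-mono (─-⊆ W N) x))
                  (∑-mono-≤ λ x → 𝟙*-monoʳ (N x) (d≤deg x ∘ N⊆W x)) ⟩
    ∑[ x < n ] (𝟙 ((W ─ N) x) * degree W x) + ∑[ x < n ] (𝟙 (N x) * degree W x)
      ≡⟨ ∑-distrib-+ (λ x → 𝟙 ((W ─ N) x) * degree W x) (λ x → 𝟙 (N x) * degree W x) ⟨
    ∑[ x < n ] (𝟙 ((W ─ N) x) * degree W x + 𝟙 (N x) * degree W x)
      ≡⟨ sum-cong-≗ (λ x → trans (cong (_* degree W x) (𝟙-split (N⊆W x)))
                                 (*-distribʳ-+ (degree W x) (𝟙 ((W ─ N) x)) (𝟙 (N x)))) ⟨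
    pairs W ∎
    where open ≤-Reasoning

  size-closedNbhd : ∀ W v → size (closedNbhd W v) ≤ suc (degree W v)
  size-closedNbhd W v = begin
    size (closedNbhd W v)                    ≤⟨ ∑-mono-≤ (λ x → bound (W x) (does (x ≟ v)) (A v x)) ⟩
    ∑[ x < n ] (δ x v + 𝟙 (W x ∧ A v x))     ≡⟨ ∑-distrib-+ (λ x → δ x v) _ ⟩
    ∑[ x < n ] δ x v + degree W v            ≡⟨ cong (_+ degree W v) (∑-δ v) ⟩
    suc (degree W v)                         ∎
    where
    open ≤-Reasoning
    bound : ∀ w e a → 𝟙 (w ∧ (e ∨ a)) ≤ 𝟙 e + 𝟙 (w ∧ a)
    bound false e a = z≤n
    bound true  e a = 𝟙-∨ e a

  closedNbhd-⊆ : ∀ W v → closedNbhd W v ⊆ W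
  closedNbhd-⊆ W v x = proj₁ ∘ to (T-∧ {W x})

  Apart : Fin n → Fin n → Set
  Apart x y = x ≢ y × ¬ T (A x y)

  Apart-sym : ∀ {x y} → Apart x y → Apart y x
  Apart-sym {x} {y} (x≢y , ¬xy) = x≢y ∘ sym , ¬xy ∘ subst T (A-sym y x)

  apart-closedNbhd : ∀ W v {x} → T (W x) → ¬ T (closedNbhd W v x) → Apart v x
  apart-closedNbhd W v {x} x∈W x∉N =
      (λ v≡x → x∉N (∈N (inj₁ (from T-≡ (dec-true (x ≟ v) (sym v≡x))))))
    , (λ v~x → x∉N (∈N (inj₂ v~x)))
    where
    ∈N : T (does (x ≟ v)) ⊎ T (A v x) → T (closedNbhd W v x)
    ∈N = from (T-∧ {W x}) ∘ (x∈W ,_) ∘ from (T-∨ {does (x ≟ v)})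

  record IndependentTransversal {a} (L : Fin a → VSet n) : Set where
    field
      pick  : Fin a → Fin n
      pick∈ : ∀ i → T (L i (pick i))
      apart : ∀ {i j} → i ≢ j → Apart (pick i) (pick j)

  open IndependentTransversal

  singleton : (L : Fin 1 → VSet n) {x : Fin n} → T (L zero x) → IndependentTransversal L
  singleton L {x} x∈L = record
    { pick  = λ _ → x
    ; pick∈ = λ { zero → x∈L }
    ; apart = λ { {zero} {zero} 0≢0 → contradiction refl 0≢0 }
    }

  extend : ∀ {a} {L : Fin (suc a) → VSet n} {M : Fin a → VSet n} j {v}
         → T (L j v) → (∀ i → M i ⊆ L (punchIn j i)) → (∀ i x → T (M i x) → Apart v x)
         → IndependentTransversal M → IndependentTransversal L
  extend {L = L} {M} j {v} v∈Lj M⊆L apartᵥ τ = record { pick = u ; pick∈ = u∈ ; apart = u-apart }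
    where
    u : Fin _ → Fin n
    u = insertAt (pick τ) j v

    u∈ : ∀ k → T (L k (u k))
    u∈ k with slot j k
    ... | at      rewrite insertAt-lookup (pick τ) j v = v∈Lj
    ... | other i rewrite insertAt-punchIn (pick τ) j v i = M⊆L i _ (pick∈ τ i)

    u-apart : ∀ {k l} → k ≢ l → Apart (u k) (u l)
    u-apart {k} {l} k≢l with slot j k | slot j l
    ... | at      | at       = contradiction refl k≢l
    ... | at      | other i  rewrite insertAt-lookup (pick τ) j v | insertAt-punchIn (pick τ) j v i
                             = apartᵥ i _ (pick∈ τ i)
    ... | other i | at       rewrite insertAt-lookup (pick τ) j v | insertAt-punchIn (pick τ) j v i
                             = Apart-sym (apartᵥ i _ (pick∈ τ i))
    ... | other i | other i′ rewrite insertAt-punchIn (pick τ) j v i | insertAt-punchIn (pick τ) j v i′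
                             = apart τ (k≢l ∘ cong (punchIn j))

  pick-independent : (∀ x → ¬ T (A x x)) → ∀ {a} {L : Fin a → VSet n} (τ : IndependentTransversal L)
                   → ∀ i j → ¬ T (A (pick τ i) (pick τ j))
  pick-independent irrefl τ i j with i ≟ j
  ... | yes refl = irrefl (pick τ i)
  ... | no  i≢j  = proj₂ (apart τ i≢j)

  deleteNbhd : ∀ {a} (L : Fin (suc a) → VSet n) (j : Fin (suc a)) (v : Fin n) → Fin a → VSet n
  deleteNbhd L j v i = L (punchIn j i) ─ closedNbhd (⋃ L) v

  deleteNbhd-⊆ : ∀ {a} (L : Fin (suc a) → VSet n) j v i → deleteNbhd L j v i ⊆ L (punchIn j i)
  deleteNbhd-⊆ L j v i = ─-⊆ (L (punchIn j i)) (closedNbhd (⋃ L) v)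

  deleteNbhd-apart : ∀ {a} (L : Fin (suc a) → VSet n) j v i x → T (deleteNbhd L j v i x) → Apart v x
  deleteNbhd-apart L j v i x x∈M =
    apart-closedNbhd (⋃ L) v (⊆-⋃ L (punchIn j i) x (deleteNbhd-⊆ L j v i x x∈M))
                             (─-∉ (L (punchIn j i)) (closedNbhd (⋃ L) v) x x∈M)

  deleteNbhd-large : ∀ {a s} (L : Fin (suc a) → VSet n) j v → (∀ i → s ≤ size (L i))
                   → ∀ i → s ∸ size (closedNbhd (⋃ L) v) ≤ size (deleteNbhd L j v i)
  deleteNbhd-large {s = s} L j v large i =
    m≤n+o⇒m∸n≤o s _ (≤-trans (large (punchIn j i)) (size-─ (L (punchIn j i)) (closedNbhd (⋃ L) v)))

  deleteNbhd-below : ∀ k {s} (L : Fin (suc (suc k)) → VSet n) j {v}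
                   → (∀ x → T (⋃ L x) → degree (⋃ L) v ≤ degree (⋃ L) x)
                   → BelowThreshold s (suc k) (pairs (⋃ L))
                   → BelowThreshold (s ∸ size (closedNbhd (⋃ L) v)) k (pairs (⋃ (deleteNbhd L j v)))
  deleteNbhd-below k L j {v} v-min = BelowThreshold-step k (size-closedNbhd W v)
    (≤-trans (+-monoˡ-≤ _ (pairs-mono (⋃-least λ i → ─-monoˡ N (⊆-⋃ L (punchIn j i)))))
             (pairs-─ W N (closedNbhd-⊆ W v) v-min))
    where
    W : VSet n
    W = ⋃ L
    N : VSet n
    N = closedNbhd W v

  transversal : ∀ k {s} (L : Fin (suc k) → VSet n) → (∀ i → s ≤ size (L i))
              → BelowThreshold s k (pairs (⋃ L)) → IndependentTransversal L
  transversal zero L large below =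
    let (x , x∈L₀) = size-pos⇒nonempty (L zero) (≤-trans below (large zero))
    in  singleton L x∈L₀
  transversal (suc k) L large below =
    let 0<s               = BelowThreshold⇒0<s (suc k) below
        (w , w∈L₀)        = size-pos⇒nonempty (L zero) (≤-trans 0<s (large zero))
        (v , v∈W , v-min) = ∃-argmin (⋃ L) (degree (⋃ L)) (⊆-⋃ L zero w w∈L₀)
        (j , v∈Lj)        = ∈⋃⁻ L v∈W
    in  extend j v∈Lj (deleteNbhd-⊆ L j v) (deleteNbhd-apart L j v)
          (transversal k (deleteNbhd L j v) (deleteNbhd-large L j v large) (deleteNbhd-below k L j v-min below))

module _ {m n : ℕ} where

  _≟²_ : DecidableEquality (Fin m × Fin n)
  _≟²_ = ≡-dec _≟_ _≟_

  open import Data.List.Membership.DecPropositional _≟²_ using (_∈?_) public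

  δ² : Fin m × Fin n → Fin m × Fin n → ℕ
  δ² p q = 𝟙 (does (p ≟² q))

  δ²≡δ*δ : ∀ x y a b → δ² (x , y) (a , b) ≡ δ x a * δ y b
  δ²≡δ*δ x y a b = trans (cong 𝟙 componentwise) (𝟙-∧ (does (x ≟ a)) (does (y ≟ b)))
    where
    componentwise : does ((x , y) ≟² (a , b)) ≡ does (x ≟ a) ∧ does (y ≟ b)
    componentwise = does-⇔ (mk⇔ ,-injective λ (x≡a , y≡b) → cong₂ _,_ x≡a y≡b)
                           ((x , y) ≟² (a , b)) ((x ≟ a) ×-dec (y ≟ b))

  ∑∑-δ² : ∀ a b → ∑[ x < m ] ∑[ y < n ] δ² (x , y) (a , b) ≡ 1
  ∑∑-δ² a b = begin
    ∑[ x < m ] ∑[ y < n ] δ² (x , y) (a , b)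
      ≡⟨ sum-cong-≗ {m} (λ x → sum-cong-≗ {n} (λ y → δ²≡δ*δ x y a b)) ⟩
    ∑[ x < m ] ∑[ y < n ] (δ x a * δ y b)
      ≡⟨ sum-cong-≗ {m} (λ x → *-distribˡ-sum (δ x a) (λ y → δ y b)) ⟨
    ∑[ x < m ] (δ x a * ∑[ y < n ] δ y b)
      ≡⟨ sum-cong-≗ {m} (λ x → trans (cong (δ x a *_) (∑-δ b)) (*-identityʳ (δ x a))) ⟩
    ∑[ x < m ] δ x a
      ≡⟨ ∑-δ a ⟩
    1 ∎
    where open ≡-Reasoning

  ∑∑-𝟙-∈≤length : ∀ (es : List (Fin m × Fin n))
                → ∑[ x < m ] ∑[ y < n ] 𝟙 (does ((x , y) ∈? es)) ≤ length es
  ∑∑-𝟙-∈≤length [] =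
    ≤-reflexive (trans (sum-cong-≗ {m} λ _ → sum-replicate-zero n) (sum-replicate-zero m))
  ∑∑-𝟙-∈≤length ((a , b) ∷ es) = begin
    ∑[ x < m ] ∑[ y < n ] 𝟙 (does ((x , y) ≟² (a , b)) ∨ does ((x , y) ∈? es))
      ≤⟨ ∑∑-mono-≤ {m} {n} (λ x y → 𝟙-∨ (does ((x , y) ≟² (a , b))) (does ((x , y) ∈? es))) ⟩
    ∑[ x < m ] ∑[ y < n ] (δ² (x , y) (a , b) + 𝟙 (does ((x , y) ∈? es)))
      ≡⟨ ∑∑-distrib-+ (λ x y → δ² (x , y) (a , b)) (λ x y → 𝟙 (does ((x , y) ∈? es))) ⟩
    ∑[ x < m ] ∑[ y < n ] δ² (x , y) (a , b) + ∑[ x < m ] ∑[ y < n ] 𝟙 (does ((x , y) ∈? es))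
      ≤⟨ +-mono-≤ (≤-reflexive (∑∑-δ² a b)) (∑∑-𝟙-∈≤length es) ⟩
    suc (length es) ∎
    where open ≤-Reasoning

module _ {n : ℕ} (G : Graph n) where

  adjacent? : ∀ x y → Dec (adjacent G x y)
  adjacent? x y = (x , y) ∈? edges G ⊎-dec (y , x) ∈? edges G

  adjacencyᵇ : Fin n → Fin n → Bool
  adjacencyᵇ x y = does (adjacent? x y)

  adjacencyᵇ-sym : ∀ x y → adjacencyᵇ x y ≡ adjacencyᵇ y x
  adjacencyᵇ-sym x y = does-⇔ (mk⇔ Sum.swap Sum.swap) (adjacent? x y) (adjacent? y x)

  adjacent-irrefl : ∀ x → ¬ adjacent G x x
  adjacent-irrefl x = [ irrefl , irrefl ]
    where
    irrefl : (x , x) ∈ₗ edges G → ⊥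
    irrefl x∈E = Fin.<-irrefl refl (All.lookup (ordered G) x∈E)

  adjacencyᵇ-irrefl : ∀ x → ¬ T (adjacencyᵇ x x)
  adjacencyᵇ-irrefl x = subst T (dec-false (adjacent? x x) (adjacent-irrefl x))

  ∑∑-adjacencyᵇ≤ : ∑[ x < n ] ∑[ y < n ] 𝟙 (adjacencyᵇ x y) ≤ 2 * numEdges G
  ∑∑-adjacencyᵇ≤ = begin
    ∑[ x < n ] ∑[ y < n ] 𝟙 (forward x y ∨ forward y x)
      ≤⟨ ∑∑-mono-≤ {n} {n} (λ x y → 𝟙-∨ (forward x y) (forward y x)) ⟩
    ∑[ x < n ] ∑[ y < n ] (𝟙 (forward x y) + 𝟙 (forward y x))
      ≡⟨ ∑∑-distrib-+ (λ x y → 𝟙 (forward x y)) (λ x y → 𝟙 (forward y x)) ⟩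
    ∑[ x < n ] ∑[ y < n ] 𝟙 (forward x y) + ∑[ x < n ] ∑[ y < n ] 𝟙 (forward y x)
      ≡⟨ cong (∑[ x < n ] ∑[ y < n ] 𝟙 (forward x y) +_) (∑-comm (λ x y → 𝟙 (forward y x))) ⟩
    ∑[ x < n ] ∑[ y < n ] 𝟙 (forward x y) + ∑[ y < n ] ∑[ x < n ] 𝟙 (forward y x)
      ≤⟨ +-mono-≤ (∑∑-𝟙-∈≤length (edges G)) (∑∑-𝟙-∈≤length (edges G)) ⟩
    numEdges G + numEdges G
      ≡⟨ cong (numEdges G +_) (+-identityʳ (numEdges G)) ⟨
    2 * numEdges G ∎
    where
    open ≤-Reasoning
    forward : Fin n → Fin n → Bool
    forward x y = does ((x , y) ∈? edges G)

∣p∣≡size : ∀ {n} (p : Subset n) → ∣ p ∣ ≡ size (lookup p)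
∣p∣≡size Vec.[]          = refl
∣p∣≡size (true  Vec.∷ p) = cong suc (∣p∣≡size p)
∣p∣≡size (false Vec.∷ p) = ∣p∣≡size p

theorem6p2 : (s a n : ℕ) → 2 ≤ s → 2 ≤ a → (G : Graph n) → numEdges G < t s (a ∸ 1)
           → (L : Fin a → Subset n) → (∀ i → ∣ L i ∣ ≡ s)
           → Σ (Fin a → Fin n) (λ u → (∀ i → u i ∈ L i) × (∀ i j → i ≢ j → u i ≢ u j)
               × (∀ i j → ¬ adjacent G (u i) (u j)))
theorem6p2 s (suc (suc k)) n _ (s≤s (s≤s _)) G sparse L ∣L∣≡s =
  pick , pick∈L , pick-injective , independent
  where
  open Greedy (adjacencyᵇ G) (adjacencyᵇ-sym G)

  χ : Fin (suc (suc k)) → VSet n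
  χ i = lookup (L i)

  large : ∀ i → s ≤ size (χ i)
  large i = ≤-reflexive (trans (sym (∣L∣≡s i)) (∣p∣≡size (L i)))

  few-pairs : pairs (⋃ χ) < 2 * t s (suc k)
  few-pairs = ≤-<-trans (≤-trans (pairs≤∑∑ (⋃ χ)) (∑∑-adjacencyᵇ≤ G)) (*-monoʳ-< 2 sparse)

  τ : IndependentTransversal χ
  τ = transversal (suc k) χ large few-pairs

  open IndependentTransversal τ

  pick∈L : ∀ i → pick i ∈ L i
  pick∈L i = lookup⇒[]= (pick i) (L i) (to T-≡ (pick∈ i))

  pick-injective : ∀ i j → i ≢ j → pick i ≢ pick j
  pick-injective i j = proj₁ ∘ apart

  independent : ∀ i j → ¬ adjacent G (pick i) (pick j)
  independent i j = pick-independent (adjacencyᵇ-irrefl G) τ i j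
                  ∘ from T-≡ ∘ dec-true (adjacent? G (pick i) (pick j))
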